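{- Let $S$ be a semantics of logic programs that is invariant under renaming of constants, let $\mathcal{T}=\langle P,\mathcal{A},\mathcal{C}\rangle$ be an abductive theory, $O$ an observation, and $(E,F)$ a constrained explanation (of any one of the types A, B, C, D) of $O$ wrt $\mathcal{T}$. Then every constant symbol occurring in $E$ or $F$ occurs in $\mathcal{T}$ or in $O$.
   Context: Fix a vocabulary $\sigma$ of relation and constant symbols (no function symbols) whose set of constants $\mathcal{D}$ is countably infinite. A semantics $S$ assigns to each logic program $Q$ a set $\mathit{sem}_S(Q)$ of Herbrand interpretations; $Q$ is consistent if $\mathit{sem}_S(Q)\neq\emptyset$; a consistent $Q$ skeptically entails $\varphi$ ($Q\models_S\varphi$) if all $M\in\mathit{sem}_S(Q)$ satisfy $\varphi$ (for a set, each member). Invariance under renaming: applying a bijective renaming of constants to a program renames its models accordingly. An abductive theory $\mathcal{T}=\langle P,\mathcal{A},\mathcal{C}\rangle$: $P$ a finite logic program over $\sigma$, $\mathcal{A}$ a finite set of predicate symbols (abducible predicates), $\mathcal{C}$ a finite set of first-order sentences (integrity constraints), and every rule of $P$ with head predicate in $\mathcal{A}$ is a ground fact. Abducibles: ground atoms with predicate in $\mathcal{A}$. Observation: a set of ground atoms with non-abducible predicates. Agreement of $O$ with program $Q$ and $\mathcal{C}$: (A) $Q$ consistent, $Q\models_S\mathcal{C}$, $Q\models_S O$; (B) $Q\models_S O$ and some $M\in \mathit{sem}_S(Q)$ satisfies $\mathcal{C}$; (C) every $M\in\mathit{sem}_S(Q)$ with $M\models\mathcal{C}$ satisfies $O$;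 (D) some $M\in\mathit{sem}_S(Q)$ satisfies $\mathcal{C}$ and $O$. An explanation (of a given type) is a pair $(E,F)$ of disjoint finite sets of abducibles with $F\subseteq P$ such that $O$ agrees (in that sense) with $(P\cup E)\setminus F$ and $\mathcal{C}$. For a set $E$ of ground atoms, an occurrence of a constant $c$ in $E$ is a pair (atom $p(x)\in E$, position $k$) such that the $k$-th argument of $p(x)$ is $c$. For a nonempty set $C$ of occurrences of $c$ in $E$, the replacement function $f_{E,C}:\mathcal{D}\to 2^{\text{abducibles}}$ maps $x$ to the set obtained from $E$ by replacing with $x$ the constant $c$ at each occurrence in $C$. Replacement functions $f_{E,C_1}$ (for constant $c_1$) and $f_{E,C_2}$ (for $c_2$) are independent if $c_1\neq c_2$ or $C_1\cap C_2=\emptyset$. For an explanation $\Delta=(E,F)$ of $O$ wrt $\mathcal{T}$ and a constant $\xi$ not occurring in $E\cup O\cup P$, the degree of arbitrariness $\delta(\Delta)$ is the maximum number of pairwise independent replacement functions $f_{E,C}$ (possibly for different constants) such that $(f_{E,C}(\xi),F)$ is an explanation of $O$ wrt $\mathcal{T}$ (of the same type). $\Delta$ is constrained if $\delta(\Delta)=0$, and arbitrary otherwise. -}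

module Defs where

open import Data.Nat using (ℕ; suc)
open import Data.Fin using (Fin; zero; suc)
open import Data.Vec using (Vec; lookup; tabulate)
import Data.Vec as Vec
open import Data.List using (List; []; _∷_)
import Data.List as List
open import Data.List.Membership.Propositional using (_∈_)
open import Data.List.Relation.Unary.Any using (Any)
open import Data.Product using (Σ; ∃; _×_; _,_; Σ-syntax; ∃-syntax)
open import Data.Sum using (_⊎_)
open import Data.Bool using (Bool; true; false; if_then_else_)
open import Data.Empty using (⊥)
open import Relation.Nullary using (¬_)
open import Relation.Binary.PropositionalEquality using (_≡_; _≢_)
open import Function.Bundles using (_↔_; _⇔_; Inverse)

Const : Set
Const = ℕ

module Abduction (Pred : Set) (ar : Pred → ℕ) where

  -- Logic programs (rules may contain variables; disjunctive heads,
  -- possibly empty, and bodies with default negation are allowed).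

  data Term : Set where
    var : ℕ → Term
    con : Const → Term

  record Atom : Set where
    constructor atom
    field
      pred : Pred
      args : Vec Term (ar pred)

  record GAtom : Set where
    constructor gatom
    field
      gpred : Pred
      gargs : Vec Const (ar gpred)

  open GAtom public

  record Rule : Set where
    constructor rule
    field
      head : List Atom
      pos  : List Atom
      neg  : List Atom

  open Rule public

  Program : Set₁
  Program = Rule → Set

  toAtom : GAtom → Atom
  toAtom (gatom p xs) = atom p (Vec.map con xs)

  fact : GAtom → Rule
  fact a = rule (toAtom a ∷ []) [] []

  listProg : List Rule → Program
  listProg P r = r ∈ P

  facts : List GAtom → Program
  facts E r = ∃[ a ] (a ∈ E × r ≡ fact a)

  modify : List Rule → List GAtom → List GAtom → Program
  modify P E F r = (r ∈ P ⊎ facts E r) × ¬ facts F r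

  Interp : Set₁
  Interp = GAtom → Set

  renT : Const ↔ Const → Term → Term
  renT π (var v) = var v
  renT π (con c) = con (Inverse.to π c)

  renA : Const ↔ Const → Atom → Atom
  renA π (atom p ts) = atom p (Vec.map (renT π) ts)

  renR : Const ↔ Const → Rule → Rule
  renR π (rule h p n) = rule (List.map (renA π) h) (List.map (renA π) p) (List.map (renA π) n)

  renG : Const ↔ Const → GAtom → GAtom
  renG π (gatom p xs) = gatom p (Vec.map (Inverse.to π) xs)

  RenamedProg : Const ↔ Const → Program → Program → Set
  RenamedProg π Q Q' = ∀ r → Q' r ⇔ (∃[ r₀ ] (Q r₀ × r ≡ renR π r₀))

  RenamedInterp : Const ↔ Const → Interp → Interp → Set
  RenamedInterp π M M' = ∀ a → M' (renG π a) ⇔ M a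

  record Semantics : Set₁ where
    field
      sem : Program → Interp → Set

  open Semantics public

  RenamingInvariant : Semantics → Set₁
  RenamingInvariant S = ∀ (π : Const ↔ Const) (Q Q' : Program) (M M' : Interp) →
    RenamedProg π Q Q' → RenamedInterp π M M' → (sem S Q M ⇔ sem S Q' M')

  data FTerm (n : ℕ) : Set where
    fvar : Fin n → FTerm n
    fcon : Const → FTerm n

  data Formula (n : ℕ) : Set where
    rel   : (p : Pred) → Vec (FTerm n) (ar p) → Formula n
    equal : FTerm n → FTerm n → Formula n
    ¬'    : Formula n → Formula n
    _∧'_  : Formula n → Formula n → Formula n
    ∀'    : Formula (suc n) → Formula n

  _∨'_ : ∀ {n} → Formula n → Formula n → Formula n
  φ ∨' ψ = ¬' (¬' φ ∧' ¬' ψ)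

  _⇒'_ : ∀ {n} → Formula n → Formula n → Formula n
  φ ⇒' ψ = ¬' (φ ∧' ¬' ψ)

  ∃' : ∀ {n} → Formula (suc n) → Formula n
  ∃' φ = ¬' (∀' (¬' φ))

  Sentence : Set
  Sentence = Formula 0

  extEnv : ∀ {n} → (Fin n → Const) → Const → Fin (suc n) → Const
  extEnv ρ d zero = d
  extEnv ρ d (suc i) = ρ i

  evalT : ∀ {n} → (Fin n → Const) → FTerm n → Const
  evalT ρ (fvar i) = ρ i
  evalT ρ (fcon c) = c

  Sat : ∀ {n} → Interp → (Fin n → Const) → Formula n → Set
  Sat M ρ (rel p ts) = M (gatom p (Vec.map (evalT ρ) ts))
  Sat M ρ (equal s t) = evalT ρ s ≡ evalT ρ t
  Sat M ρ (¬' φ) = ¬ Sat M ρ φ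
  Sat M ρ (φ ∧' ψ) = Sat M ρ φ × Sat M ρ ψ
  Sat M ρ (∀' φ) = ∀ (d : Const) → Sat M (extEnv ρ d) φ

  emptyEnv : Fin 0 → Const
  emptyEnv ()

  SatAll : Interp → List Sentence → Set
  SatAll M C = ∀ φ → φ ∈ C → Sat M emptyEnv φ

  SatAtoms : Interp → List GAtom → Set
  SatAtoms M O = ∀ a → a ∈ O → M a

  Consistent : Semantics → Program → Set₁
  Consistent S Q = ∃[ M ] sem S Q M

  EntailsC : Semantics → Program → List Sentence → Set₁
  EntailsC S Q C = Consistent S Q × (∀ M → sem S Q M → SatAll M C)

  EntailsO : Semantics → Program → List GAtom → Set₁
  EntailsO S Q O = Consistent S Q × (∀ M → sem S Q M → SatAtoms M O)

  IsGroundFact : Rule → Set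
  IsGroundFact r = ∃[ a ] (r ≡ fact a)

  record Theory : Set where
    field
      P : List Rule
      𝒜 : List Pred
      𝒞 : List Sentence
      abdFacts : ∀ r → r ∈ P → (∃[ h ] (h ∈ head r × Atom.pred h ∈ 𝒜)) → IsGroundFact r

  open Theory public

  Abducible : Theory → GAtom → Set
  Abducible T a = gpred a ∈ 𝒜 T

  Observation : Theory → List GAtom → Set
  Observation T O = ∀ a → a ∈ O → ¬ Abducible T a

  data ExplType : Set where
    typeA typeB typeC typeD : ExplType

  Agrees : Semantics → ExplType → List GAtom → Program → List Sentence → Set₁
  Agrees S typeA O Q C = Consistent S Q × EntailsC S Q C × EntailsO S Q O
  Agrees S typeB O Q C = EntailsO S Q O × (∃[ M ] (sem S Q M × SatAll M C))
  Agrees S typeC O Q C = ∀ M → sem S Q M → SatAll M C → SatAtoms M O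
  Agrees S typeD O Q C = ∃[ M ] (sem S Q M × SatAll M C × SatAtoms M O)

  record IsExplanation (S : Semantics) (t : ExplType) (T : Theory)
                       (O : List GAtom) (E F : List GAtom) : Set₁ where
    field
      E-abd    : ∀ a → a ∈ E → Abducible T a
      F-abd    : ∀ a → a ∈ F → Abducible T a
      disjoint : ∀ a → a ∈ E → a ∈ F → ⊥
      F⊆P      : ∀ a → a ∈ F → fact a ∈ P T
      agrees   : Agrees S t O (modify (P T) E F) (𝒞 T)

  OccT : Const → Term → Set
  OccT c (var v) = ⊥
  OccT c (con d) = c ≡ d

  OccA : Const → Atom → Set
  OccA c (atom p ts) = ∃[ k ] OccT c (lookup ts k)

  OccR : Const → Rule → Set
  OccR c (rule h p n) = Any (OccA c) h ⊎ Any (OccA c) p ⊎ Any (OccA c) n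

  OccG : Const → GAtom → Set
  OccG c a = ∃[ k ] (lookup (gargs a) k ≡ c)

  OccGs : Const → List GAtom → Set
  OccGs c E = Any (OccG c) E

  OccFT : ∀ {n} → Const → FTerm n → Set
  OccFT c (fvar i) = ⊥
  OccFT c (fcon d) = c ≡ d

  OccF : ∀ {n} → Const → Formula n → Set
  OccF c (rel p ts) = ∃[ k ] OccFT c (lookup ts k)
  OccF c (equal s t) = OccFT c s ⊎ OccFT c t
  OccF c (¬' φ) = OccF c φ
  OccF c (φ ∧' ψ) = OccF c φ ⊎ OccF c ψ
  OccF c (∀' φ) = OccF c φ

  OccP : Const → List Rule → Set
  OccP c P = Any (OccR c) P

  -- occurrence in the abductive theory (abducible predicates contain no constants)
  OccTheory : Const → Theory → Set
  OccTheory c T = OccP c (P T) ⊎ Any (OccF c) (𝒞 T)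

  -- A nonempty set C of occurrences of the constant c in E, given by a
  -- selector: the occurrence (a , k) (a ∈ E, k a position) is in C iff
  -- sel a k ≡ true.
  record OccSet (E : List GAtom) : Set where
    field
      const    : Const
      sel      : (a : GAtom) → Fin (ar (gpred a)) → Bool
      selOcc   : ∀ a k → a ∈ E → sel a k ≡ true → lookup (gargs a) k ≡ const
      nonempty : ∃[ a ] ∃[ k ] (a ∈ E × sel a k ≡ true)

  open OccSet public

  replaceAtom : ((a : GAtom) → Fin (ar (gpred a)) → Bool) → Const → GAtom → GAtom
  replaceAtom s x a = gatom (gpred a) (tabulate (λ k → if s a k then x else lookup (gargs a) k))

  replFun : (E : List GAtom) → OccSet E → Const → List GAtom
  replFun E C x = List.map (replaceAtom (sel C) x) E

  Independent : {E : List GAtom} → OccSet E → OccSet E → Set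
  Independent {E} C₁ C₂ =
    const C₁ ≢ const C₂ ⊎
    (∀ a k → a ∈ E → sel C₁ a k ≡ true → sel C₂ a k ≡ true → ⊥)

  HasIndepRepl : Semantics → ExplType → Theory → List GAtom →
                 (E F : List GAtom) → Const → ℕ → Set₁
  HasIndepRepl S t T O E F ξ k =
    Σ[ Cs ∈ (Fin k → OccSet E) ]
      ((∀ i j → i ≢ j → Independent (Cs i) (Cs j)) ×
       (∀ i → IsExplanation S t T O (replFun E (Cs i) ξ) F))

  FreshFor : Const → Theory → List GAtom → List GAtom → Set
  FreshFor ξ T O E = ¬ OccGs ξ E × ¬ OccGs ξ O × ¬ OccP ξ (P T)

  -- δ(E,F) = 0 (for every admissible choice of ξ): the maximum number of
  -- pairwise independent such replacement functions is 0
  Constrained : Semantics → ExplType → Theory → List GAtom → (E F : List GAtom) → Set₁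
  Constrained S t T O E F =
    ∀ ξ → FreshFor ξ T O E → ∀ k → HasIndepRepl S t T O E F ξ k → k ≡ 0

-- Suppose a constant c occurs in E but neither in the theory nor in the
-- observation (if it occurs in F it occurs in P, since F ⊆ P). Choose ξ
-- beyond every constant of E, O and the theory, and let π be the
-- transposition c ↔ ξ. Then π fixes P, F, O and 𝒞, and maps E to the
-- set f_{E,C}(ξ) obtained by replacing every occurrence of c by ξ. By
-- invariance under renaming, π maps the models of (P ∪ E) ∖ F bijectively
-- onto those of (P ∪ π E) ∖ F, and it preserves satisfaction of 𝒞 and O;
-- so (f_{E,C}(ξ), F) is an explanation of the same type, and δ(E, F) ≥ 1.
module Submission where

open import Defs
open import Data.Nat using (ℕ; zero; suc; _<_; _⊔_; _≟_)
open import Data.Nat.Properties using (≤-refl; n≮n; m<n⇒m<n⊔o; m<n⇒m<o⊔n; ≡ᵇ⇒≡; 1+n≢0)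
open import Data.Bool using (if_then_else_)
open import Data.Bool.Properties using (T-≡)
open import Data.Empty using (⊥; ⊥-elim)
open import Data.Fin using (Fin; zero; suc)
import Data.Fin.Properties as Fin
open import Data.List using (List; []; _∷_)
import Data.List as List
open import Data.List.Properties using (map-id-local; map-cong-local)
open import Data.List.Membership.Propositional using (_∈_; find; lose)
open import Data.List.Membership.Propositional.Properties using (∈-map⁺; ∈-map⁻)
open import Data.List.Relation.Unary.Any using (Any; here; there)
import Data.List.Relation.Unary.Any as Any
import Data.List.Relation.Unary.All as All
open import Data.Product using (_×_; _,_; ∃-syntax)
open import Data.Product.Function.NonDependent.Propositional using (_×-⇔_)
open import Data.Sum using (_⊎_; inj₁; inj₂)
open import Data.Vec using (Vec; []; _∷_; lookup; tabulate)
import Data.Vec as Vec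
open import Data.Vec.Properties using (map-∘; map-id; map-cong; lookup-map; tabulate-cong; tabulate-∘; tabulate∘lookup)
open import Function using (_∘_; id)
open import Function.Bundles using (_↔_; _⇔_; Inverse; mk↔ₛ′; mk⇔; Equivalence)
open import Function.Construct.Symmetry using (↔-sym)
open import Function.Related.TypeIsomorphisms using (¬-cong-⇔)
open import Relation.Nullary using (¬_; Dec; yes; no; does)
open import Relation.Nullary.Decidable using (dec-true; dec-false; _⊎-dec_)
open import Relation.Binary.PropositionalEquality
  using (_≡_; _≢_; _≗_; refl; sym; trans; cong; cong₂; subst; module ≡-Reasoning)

≡⇒⇔ : ∀ {A : Set} (P : A → Set) {x y : A} → x ≡ y → P x ⇔ P y
≡⇒⇔ P x≡y = mk⇔ (subst P x≡y) (subst P (sym x≡y))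

Bounded : (ℕ → Set) → Set
Bounded P = ∃[ n ] (∀ d → P d → d < n)

module _ {P Q : ℕ → Set} where

  bounded-mono : (∀ d → Q d → P d) → Bounded P → Bounded Q
  bounded-mono Q⇒P (n , bound) = n , λ d q → bound d (Q⇒P d q)

  bounded-⊎ : Bounded P → Bounded Q → Bounded (λ d → P d ⊎ Q d)
  bounded-⊎ (m , boundP) (n , boundQ) = m ⊔ n , λ where
    d (inj₁ p) → m<n⇒m<n⊔o n (boundP d p)
    d (inj₂ q) → m<n⇒m<o⊔n m (boundQ d q)

bounded-⊥ : Bounded (λ _ → ⊥)
bounded-⊥ = 0 , λ _ ()

bounded-≡ : ∀ c → Bounded (c ≡_)
bounded-≡ c = suc c , λ { _ refl → ≤-refl }

bounded-∃Fin : ∀ {m} {P : Fin m → ℕ → Set} → (∀ k → Bounded (P k)) → Bounded (λ d → ∃[ k ] P k d)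
bounded-∃Fin {zero}  _      = 0 , λ { _ (() , _) }
bounded-∃Fin {suc m} bounds =
  bounded-mono (λ { _ (zero , p) → inj₁ p ; _ (suc k , p) → inj₂ (k , p) })
               (bounded-⊎ (bounds zero) (bounded-∃Fin (bounds ∘ suc)))

bounded-Any : ∀ {A : Set} {P : ℕ → A → Set} (xs : List A) →
              (∀ x → Bounded (λ d → P d x)) → Bounded (λ d → Any (P d) xs)
bounded-Any []       _      = bounded-mono (λ _ ()) bounded-⊥
bounded-Any (x ∷ xs) bounds =
  bounded-mono (λ { _ (here p) → inj₁ p ; _ (there q) → inj₂ q })
               (bounded-⊎ (bounds x) (bounded-Any xs bounds))

bounded⇒fresh : ∀ {P} → Bounded P → ∃[ ξ ] ¬ P ξ
bounded⇒fresh (n , bound) = n , λ p → n≮n n (bound n p)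

map-cong-lookup : ∀ {A B : Set} {n} {f g : A → B} (xs : Vec A n) →
                  (∀ k → f (lookup xs k) ≡ g (lookup xs k)) → Vec.map f xs ≡ Vec.map g xs
map-cong-lookup []       _  = refl
map-cong-lookup (x ∷ xs) eq = cong₂ _∷_ (eq zero) (map-cong-lookup xs (eq ∘ suc))

map-fixed-lookup : ∀ {A : Set} {n} {f : A → A} (xs : Vec A n) →
                   (∀ k → f (lookup xs k) ≡ lookup xs k) → Vec.map f xs ≡ xs
map-fixed-lookup xs fixed = trans (map-cong-lookup xs fixed) (map-id xs)

transpose : ℕ → ℕ → ℕ → ℕ
transpose c ξ x = if does (x ≟ c) then ξ else if does (x ≟ ξ) then c else x

module _ (c ξ : ℕ) where

  transpose-fixes : ∀ {x} → x ≢ c → x ≢ ξ → transpose c ξ x ≡ x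
  transpose-fixes {x} x≢c x≢ξ rewrite dec-false (x ≟ c) x≢c | dec-false (x ≟ ξ) x≢ξ = refl

  transpose-first : transpose c ξ c ≡ ξ
  transpose-first rewrite dec-true (c ≟ c) refl = refl

  transpose-second : transpose c ξ ξ ≡ c
  transpose-second with ξ ≟ c
  ... | yes ξ≡c rewrite dec-true (ξ ≟ c) ξ≡c = ξ≡c
  ... | no  ξ≢c rewrite dec-false (ξ ≟ c) ξ≢c | dec-true (ξ ≟ ξ) refl = refl

  transpose-involutive : ∀ x → transpose c ξ (transpose c ξ x) ≡ x
  transpose-involutive x with x ≟ c | x ≟ ξ
  ... | yes refl | _        = trans (cong (transpose c ξ) transpose-first) transpose-second
  ... | no  _    | yes refl = trans (cong (transpose c ξ) transpose-second) transpose-first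
  ... | no  x≢c  | no  x≢ξ  = trans (cong (transpose c ξ) (transpose-fixes x≢c x≢ξ)) (transpose-fixes x≢c x≢ξ)

  replace≡transpose : ∀ {x} → x ≢ ξ → (if does (x ≟ c) then ξ else x) ≡ transpose c ξ x
  replace≡transpose {x} x≢ξ with x ≟ c
  ... | yes x≡c rewrite dec-true (x ≟ c) x≡c = refl
  ... | no  x≢c rewrite dec-false (x ≟ c) x≢c | dec-false (x ≟ ξ) x≢ξ = refl

transposition : ℕ → ℕ → ℕ ↔ ℕ
transposition c ξ = mk↔ₛ′ (transpose c ξ) (transpose c ξ) (transpose-involutive c ξ) (transpose-involutive c ξ)

_Fixes_ : Const ↔ Const → (Const → Set) → Set
π Fixes Q = ∀ d → Q d → Inverse.to π d ≡ d

fixes-sym : ∀ π {Q} → π Fixes Q → ↔-sym π Fixes Q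
fixes-sym π fixed d q = trans (cong (Inverse.from π) (sym (fixed d q))) (Inverse.strictlyInverseʳ π d)

transposition-fixes : ∀ {c ξ} {Q : Const → Set} → ¬ Q c → ¬ Q ξ → transposition c ξ Fixes Q
transposition-fixes ¬Qc ¬Qξ d q = transpose-fixes _ _ (λ { refl → ¬Qc q }) (λ { refl → ¬Qξ q })

module _ (Pred : Set) (ar : Pred → ℕ) where
  open Abduction Pred ar

  OccT-bounded : ∀ t → Bounded (λ d → OccT d t)
  OccT-bounded (var _) = bounded-⊥
  OccT-bounded (con e) = bounded-mono (λ _ → sym) (bounded-≡ e)

  OccA-bounded : ∀ a → Bounded (λ d → OccA d a)
  OccA-bounded (atom _ ts) = bounded-∃Fin (λ k → OccT-bounded (lookup ts k))

  OccR-bounded : ∀ r → Bounded (λ d → OccR d r)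
  OccR-bounded (rule hd ps ns) =
    bounded-⊎ (bounded-Any hd OccA-bounded) (bounded-⊎ (bounded-Any ps OccA-bounded) (bounded-Any ns OccA-bounded))

  OccG-bounded : ∀ a → Bounded (λ d → OccG d a)
  OccG-bounded a = bounded-∃Fin (λ k → bounded-≡ (lookup (gargs a) k))

  OccFT-bounded : ∀ {n} (t : FTerm n) → Bounded (λ d → OccFT d t)
  OccFT-bounded (fvar _) = bounded-⊥
  OccFT-bounded (fcon e) = bounded-mono (λ _ → sym) (bounded-≡ e)

  OccF-bounded : ∀ {n} (φ : Formula n) → Bounded (λ d → OccF d φ)
  OccF-bounded (rel _ ts)  = bounded-∃Fin (λ k → OccFT-bounded (lookup ts k))
  OccF-bounded (equal s t) = bounded-⊎ (OccFT-bounded s) (OccFT-bounded t)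
  OccF-bounded (¬' φ)      = OccF-bounded φ
  OccF-bounded (φ ∧' ψ)    = bounded-⊎ (OccF-bounded φ) (OccF-bounded ψ)
  OccF-bounded (∀' φ)      = OccF-bounded φ

  OccTheory-bounded : ∀ T → Bounded (λ d → OccTheory d T)
  OccTheory-bounded T = bounded-⊎ (bounded-Any (P T) OccR-bounded) (bounded-Any (𝒞 T) OccF-bounded)

  OccGs-bounded : ∀ E → Bounded (λ d → OccGs d E)
  OccGs-bounded E = bounded-Any E OccG-bounded

  occT? : ∀ c t → Dec (OccT c t)
  occT? c (var _) = no λ ()
  occT? c (con d) = c ≟ d

  occA? : ∀ c a → Dec (OccA c a)
  occA? c (atom _ ts) = Fin.any? (λ k → occT? c (lookup ts k))

  occR? : ∀ c r → Dec (OccR c r)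
  occR? c (rule hd ps ns) = Any.any? (occA? c) hd ⊎-dec (Any.any? (occA? c) ps ⊎-dec Any.any? (occA? c) ns)

  occG? : ∀ c a → Dec (OccG c a)
  occG? c a = Fin.any? (λ k → lookup (gargs a) k ≟ c)

  occFT? : ∀ {n} c (t : FTerm n) → Dec (OccFT c t)
  occFT? c (fvar _) = no λ ()
  occFT? c (fcon d) = c ≟ d

  occF? : ∀ {n} c (φ : Formula n) → Dec (OccF c φ)
  occF? c (rel _ ts)  = Fin.any? (λ k → occFT? c (lookup ts k))
  occF? c (equal s t) = occFT? c s ⊎-dec occFT? c t
  occF? c (¬' φ)      = occF? c φ
  occF? c (φ ∧' ψ)    = occF? c φ ⊎-dec occF? c ψ
  occF? c (∀' φ)      = occF? c φ

  occTheory? : ∀ c T → Dec (OccTheory c T)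
  occTheory? c T = Any.any? (occR? c) (P T) ⊎-dec Any.any? (occF? c) (𝒞 T)

  occGs? : ∀ c E → Dec (OccGs c E)
  occGs? c E = Any.any? (occG? c) E

  OccG⇒OccR-fact : ∀ {d} b → OccG d b → OccR d (fact b)
  OccG⇒OccR-fact (gatom _ xs) (k , x≡d) = inj₁ (here (k , subst (OccT _) (sym (lookup-map k con xs)) (sym x≡d)))

  evalT-cong : ∀ {n} {ρ ρ′ : Fin n → Const} → ρ ≗ ρ′ → ∀ t → evalT ρ t ≡ evalT ρ′ t
  evalT-cong ρ≗ρ′ (fvar i) = ρ≗ρ′ i
  evalT-cong ρ≗ρ′ (fcon _) = refl

  extEnv-cong : ∀ {n} {ρ ρ′ : Fin n → Const} → ρ ≗ ρ′ → ∀ d → extEnv ρ d ≗ extEnv ρ′ d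
  extEnv-cong ρ≗ρ′ d zero    = refl
  extEnv-cong ρ≗ρ′ d (suc i) = ρ≗ρ′ i

  Sat-resp-≗ : ∀ {n} M {ρ ρ′ : Fin n → Const} → ρ ≗ ρ′ → ∀ φ → Sat M ρ φ → Sat M ρ′ φ
  Sat-resp-≗ M ρ≗ρ′ (rel p ts)  = subst (M ∘ gatom p) (map-cong (evalT-cong ρ≗ρ′) ts)
  Sat-resp-≗ M ρ≗ρ′ (equal s t) s≡t = trans (sym (evalT-cong ρ≗ρ′ s)) (trans s≡t (evalT-cong ρ≗ρ′ t))
  Sat-resp-≗ M ρ≗ρ′ (¬' φ) ¬sat sat = ¬sat (Sat-resp-≗ M (sym ∘ ρ≗ρ′) φ sat)
  Sat-resp-≗ M ρ≗ρ′ (φ ∧' ψ) (satφ , satψ) = Sat-resp-≗ M ρ≗ρ′ φ satφ , Sat-resp-≗ M ρ≗ρ′ ψ satψ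
  Sat-resp-≗ M ρ≗ρ′ (∀' φ) sat d = Sat-resp-≗ M (extEnv-cong ρ≗ρ′ d) φ (sat d)

  module _ (π : Const ↔ Const) where
    open Inverse π using (to; from; strictlyInverseˡ; strictlyInverseʳ)

    renT-fixed : ∀ t → π Fixes (λ d → OccT d t) → renT π t ≡ t
    renT-fixed (var _) _     = refl
    renT-fixed (con e) fixed = cong con (fixed e refl)

    renA-fixed : ∀ a → π Fixes (λ d → OccA d a) → renA π a ≡ a
    renA-fixed (atom p ts) fixed =
      cong (atom p) (map-fixed-lookup ts (λ k → renT-fixed (lookup ts k) (λ d o → fixed d (k , o))))

    renAs-fixed : ∀ as → π Fixes (λ d → Any (OccA d) as) → List.map (renA π) as ≡ as
    renAs-fixed as fixed = map-id-local (All.tabulate (λ {a} a∈as → renA-fixed a (λ d o → fixed d (lose a∈as o))))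

    renR-fixed : ∀ r → π Fixes (λ d → OccR d r) → renR π r ≡ r
    renR-fixed (rule hd ps ns) fixed
      rewrite renAs-fixed hd (λ d → fixed d ∘ inj₁)
            | renAs-fixed ps (λ d → fixed d ∘ inj₂ ∘ inj₁)
            | renAs-fixed ns (λ d → fixed d ∘ inj₂ ∘ inj₂) = refl

    renG-fixed : ∀ a → π Fixes (λ d → OccG d a) → renG π a ≡ a
    renG-fixed (gatom p xs) fixed = cong (gatom p) (map-fixed-lookup xs (λ k → fixed _ (k , refl)))

    renR-fact : ∀ a → renR π (fact a) ≡ fact (renG π a)
    renR-fact (gatom p xs) =
      cong (λ ts → rule (atom p ts ∷ []) [] []) (trans (sym (map-∘ (renT π) con xs)) (map-∘ con to xs))

    renG-inverse : ∀ a → renG (↔-sym π) (renG π a) ≡ a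
    renG-inverse (gatom p xs) = cong (gatom p) (trans (sym (map-∘ from to xs)) (map-fixed-lookup xs (strictlyInverseʳ ∘ lookup xs)))

    evalT-rename : ∀ {n} (ρ : Fin n → Const) t → π Fixes (λ d → OccFT d t) → to (evalT ρ t) ≡ evalT (to ∘ ρ) t
    evalT-rename ρ (fvar _) _     = refl
    evalT-rename ρ (fcon d) fixed = fixed d refl

    extEnv-rename : ∀ {n} (ρ : Fin n → Const) d → to ∘ extEnv ρ d ≗ extEnv (to ∘ ρ) (to d)
    extEnv-rename ρ d zero    = refl
    extEnv-rename ρ d (suc _) = refl

    -- the quantifier case needs π surjective and the equality case π injective
    Sat-rename : ∀ {n} M (ρ : Fin n → Const) φ → π Fixes (λ d → OccF d φ) →
                 Sat (M ∘ renG π) ρ φ ⇔ Sat M (to ∘ ρ) φ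
    Sat-rename M ρ (rel p ts) fixed = ≡⇒⇔ (M ∘ gatom p) (begin
      Vec.map to (Vec.map (evalT ρ) ts)  ≡⟨ map-∘ to (evalT ρ) ts ⟨
      Vec.map (to ∘ evalT ρ) ts          ≡⟨ map-cong-lookup ts (λ k → evalT-rename ρ (lookup ts k) (λ d o → fixed d (k , o))) ⟩
      Vec.map (evalT (to ∘ ρ)) ts        ∎)
      where open ≡-Reasoning
    Sat-rename M ρ (equal s t) fixed = mk⇔
      (λ s≡t → trans (sym (renamed s inj₁)) (trans (cong to s≡t) (renamed t inj₂)))
      (λ s≡t → injective (trans (renamed s inj₁) (trans s≡t (sym (renamed t inj₂)))))
      where
      renamed : ∀ u → (∀ {d} → OccFT d u → OccF d (equal s t)) → to (evalT ρ u) ≡ evalT (to ∘ ρ) u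
      renamed u inj = evalT-rename ρ u (λ d → fixed d ∘ inj)
      injective : ∀ {x y} → to x ≡ to y → x ≡ y
      injective {x} {y} tx≡ty = trans (sym (strictlyInverseʳ x)) (trans (cong from tx≡ty) (strictlyInverseʳ y))
    Sat-rename M ρ (¬' φ) fixed = ¬-cong-⇔ (Sat-rename M ρ φ fixed)
    Sat-rename M ρ (φ ∧' ψ) fixed = Sat-rename M ρ φ (λ d → fixed d ∘ inj₁) ×-⇔ Sat-rename M ρ ψ (λ d → fixed d ∘ inj₂)
    Sat-rename M ρ (∀' φ) fixed = mk⇔
      (λ sat d → subst (λ e → Sat M (extEnv (to ∘ ρ) e) φ) (strictlyInverseˡ d)
                   (Sat-resp-≗ M (extEnv-rename ρ (from d)) φ
                     (Equivalence.to (Sat-rename M (extEnv ρ (from d)) φ fixed) (sat (from d)))))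
      (λ sat e → Equivalence.from (Sat-rename M (extEnv ρ e) φ fixed)
                   (Sat-resp-≗ M (sym ∘ extEnv-rename ρ e) φ (sat (to e))))

    SatAll-rename : ∀ M C → π Fixes (λ d → Any (OccF d) C) → SatAll (M ∘ renG π) C ⇔ SatAll M C
    SatAll-rename M C fixed = mk⇔
      (λ sat φ φ∈C → Sat-resp-≗ M (λ ()) φ (Equivalence.to (renamed φ φ∈C) (sat φ φ∈C)))
      (λ sat φ φ∈C → Equivalence.from (renamed φ φ∈C) (Sat-resp-≗ M (λ ()) φ (sat φ φ∈C)))
      where
      renamed : ∀ φ → φ ∈ C → Sat (M ∘ renG π) emptyEnv φ ⇔ Sat M (to ∘ emptyEnv) φ
      renamed φ φ∈C = Sat-rename M emptyEnv φ (λ d o → fixed d (lose φ∈C o))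

    SatAtoms-rename : ∀ M O → π Fixes (λ d → OccGs d O) → SatAtoms (M ∘ renG π) O ⇔ SatAtoms M O
    SatAtoms-rename M O fixed = mk⇔
      (λ sat a a∈O → subst M (renamed a a∈O) (sat a a∈O))
      (λ sat a a∈O → subst M (sym (renamed a a∈O)) (sat a a∈O))
      where
      renamed : ∀ a → a ∈ O → renG π a ≡ a
      renamed a a∈O = renG-fixed a (λ d o → fixed d (lose a∈O o))

  modify-renamed : ∀ π (P : List Rule) E F → π Fixes (λ d → OccP d P) → (∀ b → b ∈ F → fact b ∈ P) →
                   RenamedProg π (modify P E F) (modify P (List.map (renG π) E) F)
  modify-renamed π P E F fixed F⊆P r = mk⇔ forth back
    where
    open ≡-Reasoning
    Q Q′ : Program
    Q  = modify P E F
    Q′ = modify P (List.map (renG π) E) F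

    P-fixed : ∀ π′ → π′ Fixes (λ d → OccP d P) → ∀ {r} → r ∈ P → renR π′ r ≡ r
    P-fixed π′ fixed′ {r} r∈P = renR-fixed π′ r (λ d o → fixed′ d (lose r∈P o))

    F-fixed : ∀ π′ → π′ Fixes (λ d → OccP d P) → ∀ {b} → b ∈ F → renR π′ (fact b) ≡ fact b
    F-fixed π′ fixed′ b∈F = P-fixed π′ fixed′ (F⊆P _ b∈F)

    forth : Q′ r → ∃[ r₀ ] (Q r₀ × r ≡ renR π r₀)
    forth (inj₁ r∈P , r∉F) = r , (inj₁ r∈P , r∉F) , sym (P-fixed π fixed r∈P)
    forth (inj₂ (_ , a′∈πE , refl) , r∉F) with ∈-map⁻ (renG π) a′∈πE
    ... | a , a∈E , refl = fact a , (inj₂ (a , a∈E , refl) , fact-a∉F) , sym (renR-fact π a)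
      where
      fact-a∉F : ¬ facts F (fact a)
      fact-a∉F (b , b∈F , fact-a≡fact-b) = r∉F (b , b∈F , (begin
        fact (renG π a)   ≡⟨ renR-fact π a ⟨
        renR π (fact a)   ≡⟨ cong (renR π) fact-a≡fact-b ⟩
        renR π (fact b)   ≡⟨ F-fixed π fixed b∈F ⟩
        fact b            ∎))

    back : ∃[ r₀ ] (Q r₀ × r ≡ renR π r₀) → Q′ r
    back (r₀ , (inj₁ r₀∈P , r₀∉F) , refl) = subst Q′ (sym (P-fixed π fixed r₀∈P)) (inj₁ r₀∈P , r₀∉F)
    back (_ , (inj₂ (a , a∈E , refl) , fact-a∉F) , refl) =
      subst Q′ (sym (renR-fact π a)) (inj₂ (renG π a , ∈-map⁺ (renG π) a∈E , refl) , fact-πa∉F)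
      where
      fact-πa∉F : ¬ facts F (fact (renG π a))
      fact-πa∉F (b , b∈F , fact-πa≡fact-b) = fact-a∉F (b , b∈F , (begin
        fact a                                 ≡⟨ cong fact (renG-inverse π a) ⟨
        fact (renG (↔-sym π) (renG π a))       ≡⟨ renR-fact (↔-sym π) (renG π a) ⟨
        renR (↔-sym π) (fact (renG π a))       ≡⟨ cong (renR (↔-sym π)) fact-πa≡fact-b ⟩
        renR (↔-sym π) (fact b)                ≡⟨ F-fixed (↔-sym π) (fixes-sym π fixed) b∈F ⟩
        fact b                                 ∎))

  Agrees-rename : ∀ S t O {Q Q′} C π → RenamingInvariant S → RenamedProg π Q Q′ →
                  π Fixes (λ d → OccGs d O) → π Fixes (λ d → Any (OccF d) C) →
                  Agrees S t O Q C → Agrees S t O Q′ C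
  Agrees-rename S t O {Q} {Q′} C π invariant renamed O-fixed C-fixed = transfer t
    where
    image preimage : Interp → Interp
    image    M = M ∘ renG (↔-sym π)
    preimage N = N ∘ renG π

    image-model : ∀ {M} → sem S Q M → sem S Q′ (image M)
    image-model {M} = Equivalence.to (invariant π Q Q′ M (image M) renamed (≡⇒⇔ M ∘ renG-inverse π))

    preimage-model : ∀ {N} → sem S Q′ N → sem S Q (preimage N)
    preimage-model {N} = Equivalence.from (invariant π Q Q′ (preimage N) N renamed (λ _ → mk⇔ id id))

    image-C : ∀ M → SatAll M C → SatAll (image M) C
    image-C M = Equivalence.from (SatAll-rename (↔-sym π) M C (fixes-sym π C-fixed))

    image-O : ∀ M → SatAtoms M O → SatAtoms (image M) O
    image-O M = Equivalence.from (SatAtoms-rename (↔-sym π) M O (fixes-sym π O-fixed))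

    preimage-C : ∀ N → SatAll N C → SatAll (preimage N) C
    preimage-C N = Equivalence.from (SatAll-rename π N C C-fixed)

    preimage-C⁻¹ : ∀ N → SatAll (preimage N) C → SatAll N C
    preimage-C⁻¹ N = Equivalence.to (SatAll-rename π N C C-fixed)

    preimage-O⁻¹ : ∀ N → SatAtoms (preimage N) O → SatAtoms N O
    preimage-O⁻¹ N = Equivalence.to (SatAtoms-rename π N O O-fixed)

    entails-C : (∀ M → sem S Q M → SatAll M C) → ∀ N → sem S Q′ N → SatAll N C
    entails-C entailed N N⊨Q′ = preimage-C⁻¹ N (entailed (preimage N) (preimage-model N⊨Q′))

    entails-O : (∀ M → sem S Q M → SatAtoms M O) → ∀ N → sem S Q′ N → SatAtoms N O
    entails-O entailed N N⊨Q′ = preimage-O⁻¹ N (entailed (preimage N) (preimage-model N⊨Q′))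

    transfer : ∀ t → Agrees S t O Q C → Agrees S t O Q′ C
    transfer typeA ((M , M⊨Q) , (_ , Q⊨C) , (_ , Q⊨O)) =
      (image M , image-model M⊨Q) , ((image M , image-model M⊨Q) , entails-C Q⊨C)
                                  , ((image M , image-model M⊨Q) , entails-O Q⊨O)
    transfer typeB ((_ , Q⊨O) , (M , M⊨Q , M⊨C)) =
      ((image M , image-model M⊨Q) , entails-O Q⊨O) , (image M , image-model M⊨Q , image-C M M⊨C)
    transfer typeC Q⊨C⇒O N N⊨Q′ N⊨C =
      preimage-O⁻¹ N (Q⊨C⇒O (preimage N) (preimage-model N⊨Q′) (preimage-C N N⊨C))
    transfer typeD (M , M⊨Q , M⊨C , M⊨O) = image M , image-model M⊨Q , image-C M M⊨C , image-O M M⊨O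

  IsExplanation-rename : ∀ {S t T O E F} π → RenamingInvariant S →
                         π Fixes (λ d → OccTheory d T ⊎ OccGs d O) →
                         IsExplanation S t T O E F → IsExplanation S t T O (List.map (renG π) E) F
  IsExplanation-rename {S} {t} {T} {O} {E} {F} π invariant fixed explanation = record
    { E-abd    = πE-abd
    ; F-abd    = F-abd
    ; disjoint = πE-disjoint
    ; F⊆P      = F⊆P
    ; agrees   = Agrees-rename S t O (𝒞 T) π invariant
                   (modify-renamed π (P T) E F (λ d → fixed d ∘ inj₁ ∘ inj₁) F⊆P)
                   (λ d → fixed d ∘ inj₂) (λ d → fixed d ∘ inj₁ ∘ inj₂) agrees
    }
    where
    open IsExplanation explanation

    πE-abd : ∀ a → a ∈ List.map (renG π) E → Abducible T a
    πE-abd _ a′∈πE with ∈-map⁻ (renG π) a′∈πE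
    ... | gatom _ _ , a∈E , refl = E-abd _ a∈E

    πE-disjoint : ∀ a → a ∈ List.map (renG π) E → a ∈ F → ⊥
    πE-disjoint _ a′∈πE πa∈F with ∈-map⁻ (renG π) a′∈πE
    ... | a , a∈E , refl = disjoint a a∈E (subst (_∈ F) πa≡a πa∈F)
      where
      -- π fixes the constants of F ⊆ P, hence so does π⁻¹
      πa≡a : renG π a ≡ a
      πa≡a = trans (sym (renG-fixed (↔-sym π) (renG π a) (fixes-sym π (λ d o →
               fixed d (inj₁ (inj₁ (lose (F⊆P _ πa∈F) (OccG⇒OccR-fact _ o))))))))
             (renG-inverse π a)

  allOccurrences : ∀ c E → OccGs c E → OccSet E
  allOccurrences c E c∈E = record
    { const    = c
    ; sel      = λ a k → does (lookup (gargs a) k ≟ c)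
    ; selOcc   = λ a k _ selected → ≡ᵇ⇒≡ (lookup (gargs a) k) c (Equivalence.from T-≡ selected)
    ; nonempty = let a , a∈E , k , x≡c = find c∈E in a , k , a∈E , dec-true (lookup (gargs a) k ≟ c) x≡c
    }

  replFun-allOccurrences : ∀ c ξ E (c∈E : OccGs c E) → ¬ OccGs ξ E →
                           replFun E (allOccurrences c E c∈E) ξ ≡ List.map (renG (transposition c ξ)) E
  replFun-allOccurrences c ξ E c∈E ξ∉E = map-cong-local (All.tabulate replaced)
    where
    replaced : ∀ {a} → a ∈ E → replaceAtom (OccSet.sel (allOccurrences c E c∈E)) ξ a ≡ renG (transposition c ξ) a
    replaced {gatom p xs} a∈E = cong (gatom p) (begin
      tabulate (λ k → if does (lookup xs k ≟ c) then ξ else lookup xs k)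
        ≡⟨ tabulate-cong (λ k → replace≡transpose c ξ (λ x≡ξ → ξ∉E (lose a∈E (k , x≡ξ)))) ⟩
      tabulate (transpose c ξ ∘ lookup xs)
        ≡⟨ tabulate-∘ (transpose c ξ) (lookup xs) ⟩
      Vec.map (transpose c ξ) (tabulate (lookup xs))
        ≡⟨ cong (Vec.map (transpose c ξ)) (tabulate∘lookup xs) ⟩
      Vec.map (transpose c ξ) xs ∎)
      where open ≡-Reasoning

  constrained⇒occurs : ∀ {S t T O E F} → RenamingInvariant S → IsExplanation S t T O E F →
                       Constrained S t T O E F → ∀ c → OccGs c E → OccTheory c T ⊎ OccGs c O
  constrained⇒occurs {S} {t} {T} {O} {E} {F} invariant explanation constrained c c∈E
    with occTheory? c T ⊎-dec occGs? c O
  ... | yes occurs = occurs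
  ... | no ¬occurs with bounded⇒fresh (bounded-⊎ (bounded-⊎ (OccTheory-bounded T) (OccGs-bounded O)) (OccGs-bounded E))
  ... | ξ , ξ-fresh = ⊥-elim (1+n≢0 (constrained ξ fresh 1 ((λ _ → C) , independent , λ _ → replaced)))
    where
    fresh : FreshFor ξ T O E
    fresh = ξ-fresh ∘ inj₂ , ξ-fresh ∘ inj₁ ∘ inj₂ , ξ-fresh ∘ inj₁ ∘ inj₁ ∘ inj₁

    C : OccSet E
    C = allOccurrences c E c∈E

    independent : ∀ (i j : Fin 1) → i ≢ j → Independent C C
    independent zero zero i≢j = ⊥-elim (i≢j refl)

    replaced : IsExplanation S t T O (replFun E C ξ) F
    replaced = subst (λ E′ → IsExplanation S t T O E′ F) (sym (replFun-allOccurrences c ξ E c∈E (ξ-fresh ∘ inj₂)))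
                 (IsExplanation-rename (transposition c ξ) invariant (transposition-fixes ¬occurs (ξ-fresh ∘ inj₁)) explanation)

  OccGs-F⇒OccP : ∀ {S t T O E F c} → IsExplanation S t T O E F → OccGs c F → OccP c (P T)
  OccGs-F⇒OccP explanation c∈F =
    let b , b∈F , c∈b = find c∈F in lose (IsExplanation.F⊆P explanation b b∈F) (OccG⇒OccR-fact b c∈b)

theorem1 : (Pred : Set) (ar : Pred → ℕ) → let open Abduction Pred ar in
    (S : Semantics) → RenamingInvariant S →
    (T : Theory) (O : List GAtom) → Observation T O →
    (t : ExplType) (E F : List GAtom) →
    IsExplanation S t T O E F → Constrained S t T O E F →
    ∀ (c : Const) → (OccGs c E ⊎ OccGs c F) → OccTheory c T ⊎ OccGs c O
theorem1 Pred ar S invariant T O _ t E F explanation constrained c (inj₁ c∈E) =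
  constrained⇒occurs Pred ar invariant explanation constrained c c∈E
theorem1 Pred ar S invariant T O _ t E F explanation constrained c (inj₂ c∈F) =
  inj₁ (inj₁ (OccGs-F⇒OccP Pred ar explanation c∈F))
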